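{- Let $\Delta$ be an $i$-banner simplicial complex with $i\geq 2$. Then $\Delta$ has no missing faces of size larger than $i$.
   Context: A simplicial complex $\Delta$ is a family of subsets of a vertex set closed under taking subsets and containing all singletons. A missing face of $\Delta$ is a set of vertices that is not a face but all of whose proper subsets are faces. A clique of $\Delta$ is a set $T$ of vertices every two of which form an edge; it is critical if $T\setminus\{v\}$ is a face for some $v\in T$. For a positive integer $m$, $\Delta$ is $m$-banner if every critical clique of size at least $m+1$ is a face of $\Delta$. -}

module Defs where

open import Level using (Level; suc; _⊔_)
open import Data.Nat using (ℕ; _≤_; _>_)
open import Data.Fin using (Fin)
open import Data.Fin.Subset using (Subset; _∈_; _⊆_; _⊂_; ⁅_⁆; _∪_; _-_; ∣_∣)
open import Data.Product using (Σ; ∃; _×_; _,_)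
open import Relation.Nullary using (¬_)
open import Relation.Binary.PropositionalEquality using (_≢_)

record SimplicialComplex (ℓ : Level) (n : ℕ) : Set (suc ℓ) where
  field
    Face        : Subset n → Set ℓ
    down-closed : ∀ {σ τ} → τ ⊆ σ → Face σ → Face τ
    singletons  : ∀ v → Face ⁅ v ⁆

module _ {ℓ : Level} {n : ℕ} (Δ : SimplicialComplex ℓ n) where
  open SimplicialComplex Δ

  IsMissingFace : Subset n → Set ℓ
  IsMissingFace S = ¬ Face S × (∀ τ → τ ⊂ S → Face τ)

  IsClique : Subset n → Set ℓ
  IsClique T = ∀ u v → u ∈ T → v ∈ T → u ≢ v → Face (⁅ u ⁆ ∪ ⁅ v ⁆)

  IsCriticalClique : Subset n → Set ℓ
  IsCriticalClique T = IsClique T × (∃ λ v → v ∈ T × Face (T - v))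

  IsBanner : ℕ → Set ℓ
  IsBanner m = ∀ T → IsCriticalClique T → Data.Nat.suc m ≤ ∣ T ∣ → Face T

module Submission where

-- Let S be a missing face with ∣ S ∣ > i ≥ 2.  Two observations suffice.
--   * S is a clique: for u, v ∈ S the edge {u, v} has at most two elements,
--     so it is a proper subset of S (which has at least three), hence a face.
--   * S is critical: S is nonempty, and for any v ∈ S the set S \ {v} is a
--     proper subset of S, hence a face.
-- So S is a critical clique of size ≥ i + 1, and the banner property makes S a
-- face, contradicting that it is missing.

open import Defs
open import Level using (Level)
open import Data.Nat using (ℕ; _≤_; _<_; _>_; suc; _+_; s≤s; z≤n)
open import Data.Nat.Properties
  using (≤-trans; ≤-reflexive; +-suc; +-monoʳ-≤; n≤1+n; <⇒≱)
open import Data.Fin using (Fin)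
open import Data.Fin.Subset
open import Data.Fin.Subset.Properties
open import Data.Vec using (_∷_; [])
open import Data.Product using (_×_; _,_; ∃)
open import Data.Sum using (inj₁; inj₂)
open import Relation.Nullary using (¬_; yes; no; contradiction)
open import Relation.Binary.PropositionalEquality using (_≡_; sym; subst; cong₂)

∣p∪q∣≤∣p∣+∣q∣ : ∀ {n} (p q : Subset n) → ∣ p ∪ q ∣ ≤ ∣ p ∣ + ∣ q ∣
∣p∪q∣≤∣p∣+∣q∣ []            []            = z≤n
∣p∪q∣≤∣p∣+∣q∣ (inside ∷ p)  (inside ∷ q)  =
  s≤s (≤-trans (∣p∪q∣≤∣p∣+∣q∣ p q) (+-monoʳ-≤ ∣ p ∣ (n≤1+n ∣ q ∣)))
∣p∪q∣≤∣p∣+∣q∣ (inside ∷ p)  (outside ∷ q) = s≤s (∣p∪q∣≤∣p∣+∣q∣ p q)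
∣p∪q∣≤∣p∣+∣q∣ (outside ∷ p) (inside ∷ q)  =
  ≤-trans (s≤s (∣p∪q∣≤∣p∣+∣q∣ p q)) (≤-reflexive (sym (+-suc ∣ p ∣ ∣ q ∣)))
∣p∪q∣≤∣p∣+∣q∣ (outside ∷ p) (outside ∷ q) = ∣p∪q∣≤∣p∣+∣q∣ p q

∣edge∣≤2 : ∀ {n} (u v : Fin n) → ∣ ⁅ u ⁆ ∪ ⁅ v ⁆ ∣ ≤ 2
∣edge∣≤2 u v = ≤-trans (∣p∪q∣≤∣p∣+∣q∣ ⁅ u ⁆ ⁅ v ⁆)
                       (≤-reflexive (cong₂ _+_ (∣⁅x⁆∣≡1 u) (∣⁅x⁆∣≡1 v)))

edge⊆ : ∀ {n} {S : Subset n} {u v : Fin n} → u ∈ S → v ∈ S → ⁅ u ⁆ ∪ ⁅ v ⁆ ⊆ S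
edge⊆ {u = u} {v} u∈S v∈S x∈edge with x∈p∪q⁻ ⁅ u ⁆ ⁅ v ⁆ x∈edge
... | inj₁ x∈⁅u⁆ = subst (_∈ _) (sym (x∈⁅y⁆⇒x≡y u x∈⁅u⁆)) u∈S
... | inj₂ x∈⁅v⁆ = subst (_∈ _) (sym (x∈⁅y⁆⇒x≡y v x∈⁅v⁆)) v∈S

-- A subset of strictly smaller size is a proper subset: some element of S
-- must be missing from T, since otherwise S ⊆ T would force ∣ S ∣ ≤ ∣ T ∣.
⊆∧∣<∣⇒⊂ : ∀ {n} {T S : Subset n} → T ⊆ S → ∣ T ∣ < ∣ S ∣ → T ⊂ S
⊆∧∣<∣⇒⊂ {T = T} {S} T⊆S ∣T∣<∣S∣ with nonempty? (S ∩ ∁ T)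
... | yes (x , x∈S∖T) with x∈p∩q⁻ S (∁ T) x∈S∖T
...   | x∈S , x∈∁T = T⊆S , x , x∈S , x∈∁p⇒x∉p x∈∁T
⊆∧∣<∣⇒⊂ {T = T} {S} T⊆S ∣T∣<∣S∣ | no S∖T-empty =
  contradiction (p⊆q⇒∣p∣≤∣q∣ S⊆T) (<⇒≱ ∣T∣<∣S∣)
  where
  S⊆T : S ⊆ T
  S⊆T {x} x∈S with x ∈? T
  ... | yes x∈T = x∈T
  ... | no  x∉T = contradiction (x , x∈p∩q⁺ (x∈S , x∉p⇒x∈∁p x∉T)) S∖T-empty

∣p∣>0⇒Nonempty : ∀ {n} (p : Subset n) → ∣ p ∣ > 0 → Nonempty p
∣p∣>0⇒Nonempty {n} p ∣p∣>0 with nonempty? p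
... | yes p-nonempty = p-nonempty
... | no  p-empty    = contradiction (≤-reflexive ∣p∣≡0) (<⇒≱ ∣p∣>0)
  where
  ∣p∣≡0 : ∣ p ∣ ≡ 0
  ∣p∣≡0 = subst (λ q → ∣ q ∣ ≡ 0) (sym (Empty-unique p-empty)) (∣⊥∣≡0 n)

module _ {ℓ : Level} {n : ℕ} (Δ : SimplicialComplex ℓ n) where
  open SimplicialComplex Δ

  -- A missing face with at least three vertices is a clique: each of its
  -- edges is a proper subset of it.
  missingFace⇒clique : ∀ {S} → IsMissingFace Δ S → ∣ S ∣ > 2 → IsClique Δ S
  missingFace⇒clique (_ , proper⇒face) ∣S∣>2 u v u∈S v∈S _ =
    proper⇒face _ (⊆∧∣<∣⇒⊂ (edge⊆ u∈S v∈S) (≤-trans (s≤s (∣edge∣≤2 u v)) ∣S∣>2))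

  missingFace⇒deletion-face : ∀ {S} → IsMissingFace Δ S → ∣ S ∣ > 0 →
                              ∃ λ v → v ∈ S × Face (S - v)
  missingFace⇒deletion-face {S} (_ , proper⇒face) ∣S∣>0 with ∣p∣>0⇒Nonempty S ∣S∣>0
  ... | v , v∈S = v , v∈S , proper⇒face _ (x∈p⇒p-x⊂p v∈S)

  missingFace⇒criticalClique : ∀ {S} → IsMissingFace Δ S → ∣ S ∣ > 2 →
                               IsCriticalClique Δ S
  missingFace⇒criticalClique missing ∣S∣>2 =
    missingFace⇒clique missing ∣S∣>2 ,
    missingFace⇒deletion-face missing (≤-trans (s≤s z≤n) ∣S∣>2)

lemma3p6 : {ℓ : Level} {n : ℕ} (Δ : SimplicialComplex ℓ n) (i : ℕ) →
           2 ≤ i → IsBanner Δ i →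
           (S : Subset n) → ¬ (IsMissingFace Δ S × ∣ S ∣ > i)
lemma3p6 Δ i 2≤i banner S (missing@(not-face , _) , ∣S∣>i) =
  not-face (banner S (missingFace⇒criticalClique Δ missing ∣S∣>2) ∣S∣>i)
  where
  ∣S∣>2 : ∣ S ∣ > 2
  ∣S∣>2 = ≤-trans (s≤s 2≤i) ∣S∣>i
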